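{- Let $k$ be a nonnegative integer, let $G=(V,E)$ be a connected graph and let $X\subseteq V$ be such that $\deg_G(x)\leq k+1$ for every $x\in X$. Then \[\gamma_{P,k}(G/X)-1\le \gamma_{P,k}(G)\leq \gamma_{P,k}(G/X)+c(G[X]).\]
   Context: Graphs are finite, simple and undirected; $c(H)$ denotes the number of connected components of a graph $H$ and $G[X]$ is the induced subgraph. For $X\subseteq V$, the contraction $G/X$ is the graph obtained from $G-X$ by adding a new vertex $v_X$ with $N_{G/X}(v_X)=N_G[X]\setminus X$ ($G[X]$ need not be connected). For a graph $G=(V,E)$, nonnegative integer $k$ and $S\subseteq V$, define $\mathscr P^0_{G,k}(S)=N[S]$ and $\mathscr P^{i+1}_{G,k}(S)=\mathscr P^i_{G,k}(S)\cup\bigcup\{N(v): v\in \mathscr P^i_{G,k}(S),\ 1\le |N(v)\setminus \mathscr P^i_{G,k}(S)|\le k\}$. $S$ is a $k$-power dominating set of $G$ if $\mathscr P^\ell_{G,k}(S)=V$ for some $\ell$; $\gamma_{P,k}(G)$ is the minimum size of such a set. -}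

module Defs where

open import Data.Nat using (ℕ; zero; suc; _≤_; _≤ᵇ_)
open import Data.Fin using (Fin; zero; suc)
open import Data.Fin.Subset using (Subset; ∣_∣; _∩_; ∁)
open import Data.Vec using (_∷_; lookup; tabulate)
open import Data.Bool using (Bool; true; false; _∧_; _∨_; not)
open import Data.Product using (Σ; ∃; _×_)
open import Relation.Binary.PropositionalEquality using (_≡_)

-- A finite graph: vertex set V ⊆ Fin n, adjacency relation adj
-- (only pairs of vertices of V count as edges, see E below).
record Graph (n : ℕ) : Set where
  constructor graph
  field
    V   : Subset n
    adj : Fin n → Fin n → Bool

open Graph public

in? : ∀ {n} → Subset n → Fin n → Bool
in? S v = lookup S v

IsSimple : ∀ {n} → Graph n → Set
IsSimple G = (∀ u v → adj G u v ≡ adj G v u) × (∀ v → adj G v v ≡ false)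

E : ∀ {n} → Graph n → Fin n → Fin n → Bool
E G u v = adj G u v ∧ in? (V G) u ∧ in? (V G) v

anyF : ∀ {n} → (Fin n → Bool) → Bool
anyF {zero}  f = false
anyF {suc n} f = f zero ∨ anyF (λ i → f (suc i))

N : ∀ {n} → Graph n → Fin n → Subset n
N G v = tabulate (E G v)

deg : ∀ {n} → Graph n → Fin n → ℕ
deg G v = ∣ N G v ∣

Nclosed : ∀ {n} → Graph n → Subset n → Subset n
Nclosed G S = tabulate (λ u → in? S u ∨ anyF (λ v → in? S v ∧ E G v u))

forces : ∀ {n} → Graph n → ℕ → Subset n → Fin n → Bool
forces G k P v = in? P v ∧ (1 ≤ᵇ ∣ N G v ∩ ∁ P ∣) ∧ (∣ N G v ∩ ∁ P ∣ ≤ᵇ k)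

stepP : ∀ {n} → Graph n → ℕ → Subset n → Subset n
stepP G k P = tabulate (λ u → in? P u ∨ anyF (λ v → forces G k P v ∧ E G v u))

Pow : ∀ {n} → Graph n → ℕ → Subset n → ℕ → Subset n
Pow G k S zero    = Nclosed G S
Pow G k S (suc i) = stepP G k (Pow G k S i)

_⊆ᵇ_ : ∀ {n} → Subset n → Subset n → Set
A ⊆ᵇ B = ∀ x → in? A x ≡ true → in? B x ≡ true

IsKPDS : ∀ {n} → Graph n → ℕ → Subset n → Set
IsKPDS G k S = (S ⊆ᵇ V G) × ∃ (λ ℓ → Pow G k S ℓ ≡ V G)

IsPowDomNum : ∀ {n} → Graph n → ℕ → ℕ → Set
IsPowDomNum G k m =
  (Σ (Subset _) (λ S → IsKPDS G k S × ∣ S ∣ ≡ m)) ×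
  (∀ S → IsKPDS G k S → m ≤ ∣ S ∣)

data Reach {n} (G : Graph n) : Fin n → Fin n → Set where
  here : ∀ {v} → Reach G v v
  step : ∀ {u w v} → E G u w ≡ true → Reach G w v → Reach G u v

Connected : ∀ {n} → Graph n → Set
Connected G = ∀ u v → in? (V G) u ≡ true → in? (V G) v ≡ true → Reach G u v

-- c(H) = c : a system of representatives of the components of H
NumComponents : ∀ {n} → Graph n → ℕ → Set
NumComponents {n} H c =
  Σ (Fin c → Fin n) (λ r →
    (∀ i → in? (V H) (r i) ≡ true) ×
    (∀ i j → Reach H (r i) (r j) → i ≡ j) ×
    (∀ v → in? (V H) v ≡ true → ∃ (λ i → Reach H (r i) v)))

induced : ∀ {n} → Graph n → Subset n → Graph n
induced G X = graph (X ∩ V G) (adj G)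

-- contraction G/X on Fin (suc n): vertex zero is v_X, vertex suc u is u ∈ V \ X;
-- N(v_X) = N_G[X] \ X
contract : ∀ {n} → Graph n → Subset n → Graph (suc n)
contract {n} G X = graph (true ∷ tabulate (λ u → in? (V G) u ∧ not (in? X u))) a
  where
  nbX : Fin n → Bool
  nbX u = not (in? X u) ∧ anyF (λ x → in? X x ∧ E G x u)
  a : Fin (suc n) → Fin (suc n) → Bool
  a zero    zero    = false
  a zero    (suc u) = nbX u
  a (suc u) zero    = nbX u
  a (suc u) (suc v) = adj G u v

-- Lower bound: a k-power dominating set S of G yields the k-power dominating set {v_X} ∪ (S ∖ X)
-- of G/X. Since v_X and all of N(X) ∖ X are observed from the start, every vertex outside X
-- observed in G is observed at the same stage in G/X, and a forcing vertex outside X sees at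
-- most as many unobserved neighbours in G/X as in G.
--
-- Upper bound: from a k-power dominating set S' of G/X take (S' ∖ {v_X}) together with one vertex
-- of each component of G[X]. Once a vertex a of X has its closed neighbourhood observed, every
-- neighbour w ∈ X of a is observed and has at most k + 1 neighbours, one of them (a) observed,
-- so w forces its whole neighbourhood at the next stage. Spreading along G[X] from the chosen
-- vertices, after some J stages all of N[X] is observed; from then on stage i of G/X is
-- simulated by stage i + J of G.
module Submission where

open import Data.Bool using (Bool; true; false; _∧_; _∨_; not)
open import Data.Bool.Properties using (T-≡)
open import Data.Empty using (⊥-elim)
open import Data.Fin using (Fin; zero; suc)
open import Data.Fin.Subset
  using (Subset; inside; outside; _∈_; _∉_; _⊆_; _∩_; _∪_; ∁; ⁅_⁆; ∣_∣) renaming (⊥ to ∅)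
open import Data.Fin.Subset.Properties
  using (_∈?_; drop-there; ∉⊥; x∈⁅x⁆; x∈⁅y⁆⇒x≡y; x∈p∩q⁺; x∈p∩q⁻; x∈p∪q⁺; x∈p∪q⁻; x∈∁p⇒x∉p; x∉p⇒x∈∁p;
         ⊆-antisym; p⊆q⇒∣p∣≤∣q∣; p⊂q⇒∣p∣<∣q∣; ∣p∣≤∣x∷p∣; ∣p∩q∣≤∣p∣; ∣⁅x⁆∣≡1; ∣⊥∣≡0)
open import Data.Nat using (ℕ; zero; suc; _≤_; _<_; _+_; _∸_; _⊔_; _≤ᵇ_; z≤n; s≤s)
open import Data.Nat.Properties
open import Data.Product using (∃; ∃-syntax; _×_; _,_; proj₁; proj₂; map₂)
open import Data.Sum using (_⊎_; inj₁; inj₂)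
open import Data.Vec using ([]; _∷_; tabulate; here; there)
open import Data.Vec.Properties using (lookup∘tabulate; []=⇒lookup; lookup⇒[]=)
open import Function using (_∘_; _$_)
open import Function.Bundles using (Equivalence)
open import Relation.Nullary using (yes; no; contradiction)
open import Relation.Binary.PropositionalEquality using (_≡_; refl; sym; trans; cong; subst)

open import Defs

private
  variable
    n : ℕ
    a b : Bool
    x u v w : Fin n
    p q : Subset n

∧-true⁻ : a ∧ b ≡ true → a ≡ true × b ≡ true
∧-true⁻ {true} {true} _ = refl , refl

∧-true⁺ : a ≡ true → b ≡ true → a ∧ b ≡ true
∧-true⁺ refl refl = refl

∨-true⁻ : a ∨ b ≡ true → a ≡ true ⊎ b ≡ true
∨-true⁻ {true}  _ = inj₁ refl
∨-true⁻ {false} b = inj₂ b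

∨-true⁺ˡ : a ≡ true → a ∨ b ≡ true
∨-true⁺ˡ refl = refl

∨-true⁺ʳ : b ≡ true → a ∨ b ≡ true
∨-true⁺ʳ {a = true}  _ = refl
∨-true⁺ʳ {a = false} b = b

anyF-true⁻ : (f : Fin n → Bool) → anyF f ≡ true → ∃[ i ] f i ≡ true
anyF-true⁻ {suc n} f eq with ∨-true⁻ {a = f zero} eq
... | inj₁ f0 = zero , f0
... | inj₂ fs with anyF-true⁻ (f ∘ suc) fs
...   | i , fi = suc i , fi

anyF-true⁺ : (f : Fin n → Bool) (i : Fin n) → f i ≡ true → anyF f ≡ true
anyF-true⁺ f zero    fi = ∨-true⁺ˡ fi
anyF-true⁺ f (suc i) fi = ∨-true⁺ʳ {a = f zero} (anyF-true⁺ (f ∘ suc) i fi)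

≤ᵇ-true⁻ : ∀ {m k} → (m ≤ᵇ k) ≡ true → m ≤ k
≤ᵇ-true⁻ {m} {k} eq = ≤ᵇ⇒≤ m k (Equivalence.from T-≡ eq)

≤ᵇ-true⁺ : ∀ {m k} → m ≤ k → (m ≤ᵇ k) ≡ true
≤ᵇ-true⁺ = Equivalence.to T-≡ ∘ ≤⇒≤ᵇ

∈⇒in? : x ∈ p → in? p x ≡ true
∈⇒in? = []=⇒lookup

in?⇒∈ : in? p x ≡ true → x ∈ p
in?⇒∈ = lookup⇒[]= _ _

⊆ᵇ⇒⊆ : p ⊆ᵇ q → p ⊆ q
⊆ᵇ⇒⊆ p⊆q x∈p = in?⇒∈ (p⊆q _ (∈⇒in? x∈p))

⊆⇒⊆ᵇ : p ⊆ q → p ⊆ᵇ q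
⊆⇒⊆ᵇ p⊆q _ x∈p = ∈⇒in? (p⊆q (in?⇒∈ x∈p))

not-in?⁻ : not (in? p x) ≡ true → x ∉ p
not-in?⁻ eq x∈p = contradiction (trans (sym (cong not (∈⇒in? x∈p))) eq) λ ()

not-in?⁺ : {p : Subset n} {x : Fin n} → x ∉ p → not (in? p x) ≡ true
not-in?⁺ {p = p} {x = x} x∉p with in? p x in eq
... | true  = ⊥-elim (x∉p (in?⇒∈ eq))
... | false = refl

∈-tabulate⁻ : {f : Fin n → Bool} → x ∈ tabulate f → f x ≡ true
∈-tabulate⁻ {f = f} x∈ = trans (sym (lookup∘tabulate f _)) (∈⇒in? x∈)

∈-tabulate⁺ : {f : Fin n → Bool} → f x ≡ true → x ∈ tabulate f
∈-tabulate⁺ {f = f} fx = in?⇒∈ (trans (lookup∘tabulate f _) fx)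

∣p∪q∣≤∣p∣+∣q∣ : (p q : Subset n) → ∣ p ∪ q ∣ ≤ ∣ p ∣ + ∣ q ∣
∣p∪q∣≤∣p∣+∣q∣ []            []            = z≤n
∣p∪q∣≤∣p∣+∣q∣ (outside ∷ p) (outside ∷ q) = ∣p∪q∣≤∣p∣+∣q∣ p q
∣p∪q∣≤∣p∣+∣q∣ (outside ∷ p) (inside  ∷ q) =
  subst (suc ∣ p ∪ q ∣ ≤_) (sym (+-suc ∣ p ∣ ∣ q ∣)) (s≤s (∣p∪q∣≤∣p∣+∣q∣ p q))
∣p∪q∣≤∣p∣+∣q∣ (inside  ∷ p) (t ∷ q)       =
  s≤s (≤-trans (∣p∪q∣≤∣p∣+∣q∣ p q) (+-monoʳ-≤ ∣ p ∣ (∣p∣≤∣x∷p∣ t q)))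

∣p∩∁q∣<∣p∣ : x ∈ p → x ∈ q → ∣ p ∩ ∁ q ∣ < ∣ p ∣
∣p∩∁q∣<∣p∣ {p = p} {q = q} x∈p x∈q =
  p⊂q⇒∣p∣<∣q∣ (proj₁ ∘ x∈p∩q⁻ p (∁ q) , _ , x∈p , λ x∈ → x∈∁p⇒x∉p (proj₂ (x∈p∩q⁻ p (∁ q) x∈)) x∈q)

x∈p⇒0<∣p∣ : x ∈ p → 0 < ∣ p ∣
x∈p⇒0<∣p∣ {x = x} {p = p} x∈p = subst (_≤ ∣ p ∣) (∣⁅x⁆∣≡1 x)
  (p⊆q⇒∣p∣≤∣q∣ λ y∈ → subst (_∈ p) (sym (x∈⁅y⁆⇒x≡y x y∈)) x∈p)

∣p∣≤∣q∣-pred : {p : Subset (suc n)} {q : Subset n} →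
  zero ∉ p → (∀ {x} → suc x ∈ p → x ∈ q) → ∣ p ∣ ≤ ∣ q ∣
∣p∣≤∣q∣-pred {p = outside ∷ p} _     p⊆q = p⊆q⇒∣p∣≤∣q∣ (p⊆q ∘ there)
∣p∣≤∣q∣-pred {p = inside  ∷ p} 0∉p _ = contradiction here 0∉p

∣p∣≤∣q∣-suc : {p : Subset n} {q : Subset (suc n)} → (∀ {x} → x ∈ p → suc x ∈ q) → ∣ p ∣ ≤ ∣ q ∣
∣p∣≤∣q∣-suc {p = p} {q = s ∷ q} p⊆q = ≤-trans (p⊆q⇒∣p∣≤∣q∣ (drop-there ∘ p⊆q)) (∣p∣≤∣x∷p∣ s q)

image : ∀ {c} → (Fin c → Fin n) → Subset n
image {c = zero}  r = ∅
image {c = suc c} r = ⁅ r zero ⁆ ∪ image (r ∘ suc)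

∣image∣≤ : ∀ {c} (r : Fin c → Fin n) → ∣ image r ∣ ≤ c
∣image∣≤ {n} {zero}  r = ≤-reflexive (∣⊥∣≡0 n)
∣image∣≤ {n} {suc c} r = begin
  ∣ ⁅ r zero ⁆ ∪ image (r ∘ suc) ∣       ≤⟨ ∣p∪q∣≤∣p∣+∣q∣ ⁅ r zero ⁆ (image (r ∘ suc)) ⟩
  ∣ ⁅ r zero ⁆ ∣ + ∣ image (r ∘ suc) ∣   ≡⟨ cong (_+ ∣ image (r ∘ suc) ∣) (∣⁅x⁆∣≡1 (r zero)) ⟩
  suc ∣ image (r ∘ suc) ∣               ≤⟨ s≤s (∣image∣≤ (r ∘ suc)) ⟩
  suc c                                 ∎
  where open ≤-Reasoning

∈-image : ∀ {c} (r : Fin c → Fin n) i → r i ∈ image r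
∈-image r zero    = x∈p∪q⁺ (inj₁ (x∈⁅x⁆ (r zero)))
∈-image r (suc i) = x∈p∪q⁺ (inj₂ (∈-image (r ∘ suc) i))

image⊆ : ∀ {c} (r : Fin c → Fin n) → (∀ i → r i ∈ p) → image r ⊆ p
image⊆ {c = zero}  r r∈p x∈ = contradiction x∈ ∉⊥
image⊆ {c = suc c} r r∈p x∈ with x∈p∪q⁻ ⁅ r zero ⁆ (image (r ∘ suc)) x∈
... | inj₁ x∈r0 = subst (_∈ _) (sym (x∈⁅y⁆⇒x≡y (r zero) x∈r0)) (r∈p zero)
... | inj₂ x∈rs = image⊆ (r ∘ suc) (r∈p ∘ suc) x∈rs

∀-eventually : (Q : Fin n → ℕ → Set) → (∀ x {i j} → i ≤ j → Q x i → Q x j) →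
  (∀ x → ∃ (Q x)) → ∃[ J ] ∀ x → Q x J
∀-eventually {zero}  Q mono ev = 0 , λ ()
∀-eventually {suc n} Q mono ev
  with ev zero | ∀-eventually (Q ∘ suc) (λ x → mono (suc x)) (ev ∘ suc)
... | j , q0 | J , qs = j ⊔ J , λ where
  zero    → mono zero (m≤m⊔n j J) q0
  (suc x) → mono (suc x) (m≤n⊔m j J) (qs x)

module Graphs (G : Graph n) where

  E⁻ : E G u v ≡ true → adj G u v ≡ true × u ∈ V G × v ∈ V G
  E⁻ e with ∧-true⁻ e
  ... | a , e′ with ∧-true⁻ e′
  ...   | u∈ , v∈ = a , in?⇒∈ u∈ , in?⇒∈ v∈

  E⁺ : adj G u v ≡ true → u ∈ V G → v ∈ V G → E G u v ≡ true
  E⁺ a u∈ v∈ = ∧-true⁺ a (∧-true⁺ (∈⇒in? u∈) (∈⇒in? v∈))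

  E-sym : IsSimple G → E G u v ≡ true → E G v u ≡ true
  E-sym {u = u} {v = v} (sym-adj , _) e with E⁻ e
  ... | a , u∈ , v∈ = E⁺ (trans (sym (sym-adj u v)) a) v∈ u∈

  ∈N⁻ : ∀ v → w ∈ N G v → E G v w ≡ true
  ∈N⁻ v = ∈-tabulate⁻

  ∈N⁺ : ∀ v → E G v w ≡ true → w ∈ N G v
  ∈N⁺ v = ∈-tabulate⁺

open Graphs

E-induced⁻ : (G : Graph n) (X : Subset n) → E (induced G X) u v ≡ true → E G u v ≡ true × v ∈ X
E-induced⁻ G X e with E⁻ (induced G X) e
... | a , u∈ , v∈ = E⁺ G a (proj₂ (x∈p∩q⁻ X _ u∈)) (proj₂ (x∈p∩q⁻ X _ v∈)) , proj₁ (x∈p∩q⁻ X _ v∈)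

module PowerDomination (G : Graph n) (k : ℕ) where

  ∈Nclosed⁻ : ∀ p → u ∈ Nclosed G p → u ∈ p ⊎ ∃[ v ] v ∈ p × E G v u ≡ true
  ∈Nclosed⁻ p u∈ with ∨-true⁻ (∈-tabulate⁻ u∈)
  ... | inj₁ u∈p = inj₁ (in?⇒∈ u∈p)
  ... | inj₂ any with anyF-true⁻ _ any
  ...   | v , ev with ∧-true⁻ ev
  ...     | v∈p , e = inj₂ (v , in?⇒∈ v∈p , e)

  p⊆Nclosed : ∀ p → p ⊆ Nclosed G p
  p⊆Nclosed p u∈p = ∈-tabulate⁺ (∨-true⁺ˡ (∈⇒in? u∈p))

  ∈Nclosed⁺ : ∀ p → v ∈ p → E G v u ≡ true → u ∈ Nclosed G p
  ∈Nclosed⁺ {v = v} p v∈p e = ∈-tabulate⁺ (∨-true⁺ʳ (anyF-true⁺ _ v (∧-true⁺ (∈⇒in? v∈p) e)))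

  ∈stepP⁻ : ∀ p → u ∈ stepP G k p → u ∈ p ⊎ ∃[ v ] forces G k p v ≡ true × E G v u ≡ true
  ∈stepP⁻ p u∈ with ∨-true⁻ (∈-tabulate⁻ u∈)
  ... | inj₁ u∈p = inj₁ (in?⇒∈ u∈p)
  ... | inj₂ any with anyF-true⁻ _ any
  ...   | v , ev = inj₂ (v , ∧-true⁻ ev)

  p⊆stepP : ∀ p → p ⊆ stepP G k p
  p⊆stepP p u∈p = ∈-tabulate⁺ (∨-true⁺ˡ (∈⇒in? u∈p))

  forces⁻ : ∀ p v → forces G k p v ≡ true → v ∈ p × ∣ N G v ∩ ∁ p ∣ ≤ k
  forces⁻ p v f with ∧-true⁻ f
  ... | v∈p , f′ = in?⇒∈ v∈p , ≤ᵇ-true⁻ (proj₂ (∧-true⁻ f′))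

  -- An unobserved u is itself the unobserved neighbour that lets v force.
  stepP-closes : ∀ p → v ∈ p → ∣ N G v ∩ ∁ p ∣ ≤ k → E G v u ≡ true → u ∈ stepP G k p
  stepP-closes {v = v} {u = u} p v∈p few e with u ∈? p
  ... | yes u∈p = p⊆stepP p u∈p
  ... | no  u∉p = ∈-tabulate⁺ (∨-true⁺ʳ (anyF-true⁺ _ v (∧-true⁺ forces-v e)))
    where
    some : 0 < ∣ N G v ∩ ∁ p ∣
    some = x∈p⇒0<∣p∣ (x∈p∩q⁺ (∈N⁺ G v e , x∉p⇒x∈∁p u∉p))
    forces-v : forces G k p v ≡ true
    forces-v = ∧-true⁺ (∈⇒in? v∈p) (∧-true⁺ (≤ᵇ-true⁺ some) (≤ᵇ-true⁺ few))

  Pow-mono : ∀ (S : Subset n) {i j} → i ≤ j → Pow G k S i ⊆ Pow G k S j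
  Pow-mono S {i} {j} i≤j = subst (λ m → Pow G k S i ⊆ Pow G k S m) (m∸n+n≡m i≤j) (grow (j ∸ i))
    where
    grow : ∀ d → Pow G k S i ⊆ Pow G k S (d + i)
    grow zero    = λ x∈ → x∈
    grow (suc d) = p⊆stepP _ ∘ grow d

  Pow⊆V : ∀ {S} → S ⊆ V G → ∀ i → Pow G k S i ⊆ V G
  Pow⊆V {S} S⊆V zero u∈ with ∈Nclosed⁻ S u∈
  ... | inj₁ u∈S       = S⊆V u∈S
  ... | inj₂ (_ , _ , e) = proj₂ (proj₂ (E⁻ G e))
  Pow⊆V {S} S⊆V (suc i) u∈ with ∈stepP⁻ (Pow G k S i) u∈
  ... | inj₁ u∈P       = Pow⊆V S⊆V i u∈P
  ... | inj₂ (_ , _ , e) = proj₂ (proj₂ (E⁻ G e))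

  IsKPDS-intro : ∀ {S} ℓ → S ⊆ V G → V G ⊆ Pow G k S ℓ → IsKPDS G k S
  IsKPDS-intro ℓ S⊆V V⊆P = ⊆⇒⊆ᵇ S⊆V , ℓ , ⊆-antisym (Pow⊆V S⊆V ℓ) V⊆P

  N[_]⊆_ : Fin n → Subset n → Set
  N[ x ]⊆ P = x ∈ P × (∀ {w} → E G x w ≡ true → w ∈ P)

  N[]⊆-spread : ∀ p → IsSimple G → deg G w ≤ suc k →
    N[ v ]⊆ p → E G v w ≡ true → N[ w ]⊆ stepP G k p
  N[]⊆-spread {w = w} p simple deg≤ (v∈p , Nv⊆p) e = p⊆stepP p w∈p , stepP-closes p w∈p few
    where
    w∈p = Nv⊆p e
    few : ∣ N G w ∩ ∁ p ∣ ≤ k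
    few = ≤-pred (<-≤-trans (∣p∩∁q∣<∣p∣ (∈N⁺ G w (E-sym G simple e)) v∈p) deg≤)

module Contraction (G : Graph n) (X : Subset n) where

  G/X : Graph (suc n)
  G/X = contract G X

  ∈V-contract⁻ : suc u ∈ V G/X → u ∈ V G × u ∉ X
  ∈V-contract⁻ u∈ with ∧-true⁻ (∈-tabulate⁻ (drop-there u∈))
  ... | u∈V , u∉X = in?⇒∈ u∈V , not-in?⁻ u∉X

  ∈V-contract⁺ : u ∈ V G → u ∉ X → suc u ∈ V G/X
  ∈V-contract⁺ u∈V u∉X = there (∈-tabulate⁺ (∧-true⁺ (∈⇒in? u∈V) (not-in?⁺ u∉X)))

  E-contract⁻ : E G/X (suc u) (suc v) ≡ true → E G u v ≡ true × u ∉ X × v ∉ X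
  E-contract⁻ e with E⁻ G/X e
  ... | a , u∈ , v∈ with ∈V-contract⁻ u∈ | ∈V-contract⁻ v∈
  ...   | u∈V , u∉X | v∈V , v∉X = E⁺ G a u∈V v∈V , u∉X , v∉X

  E-contract⁺ : E G u v ≡ true → u ∉ X → v ∉ X → E G/X (suc u) (suc v) ≡ true
  E-contract⁺ e u∉X v∉X with E⁻ G e
  ... | a , u∈V , v∈V = E⁺ G/X a (∈V-contract⁺ u∈V u∉X) (∈V-contract⁺ v∈V v∉X)

  E-vX⁻ : E G/X zero (suc u) ≡ true → ∃[ x ] x ∈ X × E G x u ≡ true
  E-vX⁻ {u = u} e
    with anyF-true⁻ _ (proj₂ (∧-true⁻ {a = not (in? X u)} (proj₁ (E⁻ G/X {u = zero} {v = suc u} e))))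
  ... | x , xe with ∧-true⁻ xe
  ...   | x∈X , e′ = x , in?⇒∈ x∈X , e′

  E-vX⁺ : x ∈ X → E G x u ≡ true → u ∉ X → E G/X zero (suc u) ≡ true
  E-vX⁺ {x = x} x∈X e u∉X =
    ∧-true⁺ (∧-true⁺ (not-in?⁺ u∉X) (anyF-true⁺ _ x (∧-true⁺ (∈⇒in? x∈X) e)))
            (∧-true⁺ refl (∈⇒in? (∈V-contract⁺ (proj₂ (proj₂ (E⁻ G e))) u∉X)))

  ∣N∩∁∣-contract≤ : ∀ (P : Subset n) (Q : Subset (suc n)) v → zero ∈ Q →
    (∀ {w} → w ∉ X → w ∈ P → suc w ∈ Q) → ∣ N G/X (suc v) ∩ ∁ Q ∣ ≤ ∣ N G v ∩ ∁ P ∣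
  ∣N∩∁∣-contract≤ P Q v vX∈Q sim = ∣p∣≤∣q∣-pred vX∉ unobserved
    where
    vX∉ : zero ∉ N G/X (suc v) ∩ ∁ Q
    vX∉ 0∈ = x∈∁p⇒x∉p (proj₂ (x∈p∩q⁻ (N G/X (suc v)) (∁ Q) 0∈)) vX∈Q
    unobserved : ∀ {w} → suc w ∈ N G/X (suc v) ∩ ∁ Q → w ∈ N G v ∩ ∁ P
    unobserved sw∈ with x∈p∩q⁻ (N G/X (suc v)) (∁ Q) sw∈
    ... | sw∈N , sw∉Q with E-contract⁻ (∈N⁻ G/X (suc v) sw∈N)
    ...   | e , _ , w∉X = x∈p∩q⁺ (∈N⁺ G v e , x∉p⇒x∈∁p (x∈∁p⇒x∉p sw∉Q ∘ sim w∉X))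

  ∣N∩∁∣≤contract : ∀ (P : Subset n) (Q : Subset (suc n)) v → X ⊆ P →
    (∀ {w} → suc w ∈ Q → w ∈ P) → v ∉ X → ∣ N G v ∩ ∁ P ∣ ≤ ∣ N G/X (suc v) ∩ ∁ Q ∣
  ∣N∩∁∣≤contract P Q v X⊆P sim v∉X = ∣p∣≤∣q∣-suc unobserved
    where
    unobserved : ∀ {w} → w ∈ N G v ∩ ∁ P → suc w ∈ N G/X (suc v) ∩ ∁ Q
    unobserved w∈ with x∈p∩q⁻ (N G v) (∁ P) w∈
    ... | w∈N , w∈∁P = x∈p∩q⁺ (∈N⁺ G/X (suc v) (E-contract⁺ (∈N⁻ G v w∈N) v∉X (w∉P ∘ X⊆P)) ,
                                x∉p⇒x∈∁p (w∉P ∘ sim))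
      where
      w∉P = x∈∁p⇒x∉p w∈∁P

module LowerBound (k : ℕ) (G : Graph n) (X S : Subset n) where
  open Contraction G X
  private
    module PG = PowerDomination G k
    module PQ = PowerDomination G/X k

  S/X : Subset (suc n)
  S/X = inside ∷ (S ∩ ∁ X)

  private
    P = Pow G k S
    Q = Pow G/X k S/X

  vX-observed : ∀ i → zero ∈ Q i
  vX-observed i = PQ.Pow-mono S/X {j = i} z≤n (PQ.p⊆Nclosed S/X here)

  N[X]-observed : ∀ i → x ∈ X → E G x u ≡ true → u ∉ X → suc u ∈ Q i
  N[X]-observed i x∈X e u∉X = PQ.Pow-mono S/X {j = i} z≤n (PQ.∈Nclosed⁺ S/X here (E-vX⁺ x∈X e u∉X))

  observed-outside-X : ∀ i → u ∉ X → u ∈ P i → suc u ∈ Q i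
  observed-outside-X zero u∉X u∈ with PG.∈Nclosed⁻ S u∈
  ... | inj₁ u∈S = PQ.p⊆Nclosed S/X (there (x∈p∩q⁺ (u∈S , x∉p⇒x∈∁p u∉X)))
  ... | inj₂ (v , v∈S , e) with v ∈? X
  ...   | yes v∈X = N[X]-observed 0 v∈X e u∉X
  ...   | no  v∉X = PQ.∈Nclosed⁺ S/X (there (x∈p∩q⁺ (v∈S , x∉p⇒x∈∁p v∉X))) (E-contract⁺ e v∉X u∉X)
  observed-outside-X (suc i) u∉X u∈ with PG.∈stepP⁻ (P i) u∈
  ... | inj₁ u∈P = PQ.p⊆stepP (Q i) (observed-outside-X i u∉X u∈P)
  ... | inj₂ (v , f , e) with v ∈? X | PG.forces⁻ (P i) v f
  ...   | yes v∈X | _          = N[X]-observed (suc i) v∈X e u∉X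
  ...   | no  v∉X | v∈P , few =
    PQ.stepP-closes (Q i) (observed-outside-X i v∉X v∈P)
      (≤-trans (∣N∩∁∣-contract≤ (P i) (Q i) v (vX-observed i) (observed-outside-X i)) few)
      (E-contract⁺ e v∉X u∉X)

  IsKPDS-contract : IsKPDS G k S → IsKPDS G/X k S/X
  IsKPDS-contract (S⊆V , ℓ , Pℓ≡V) = PQ.IsKPDS-intro ℓ S/X⊆V V⊆Q
    where
    S/X⊆V : S/X ⊆ V G/X
    S/X⊆V here      = here
    S/X⊆V (there u∈) with x∈p∩q⁻ S (∁ X) u∈
    ... | u∈S , u∈∁X = ∈V-contract⁺ (⊆ᵇ⇒⊆ S⊆V u∈S) (x∈∁p⇒x∉p u∈∁X)
    V⊆Q : V G/X ⊆ Q ℓ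
    V⊆Q {zero}  _  = vX-observed ℓ
    V⊆Q {suc u} u∈ with ∈V-contract⁻ u∈
    ... | u∈V , u∉X = observed-outside-X ℓ u∉X (subst (u ∈_) (sym Pℓ≡V) u∈V)

  ∣S/X∣≤ : ∣ S/X ∣ ≤ suc ∣ S ∣
  ∣S/X∣≤ = s≤s (∣p∩q∣≤∣p∣ S (∁ X))

module UpperBound (k : ℕ) (G : Graph n) (X : Subset n) (simple : IsSimple G) (X⊆V : X ⊆ V G)
  (deg≤ : ∀ {x} → x ∈ X → deg G x ≤ suc k)
  {c} (r : Fin c → Fin n) (r∈ : ∀ i → r i ∈ X ∩ V G)
  (covers : ∀ {x} → x ∈ X ∩ V G → ∃[ i ] Reach (induced G X) (r i) x)
  (s : Bool) (T : Subset n) where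
  open Contraction G X
  private
    module PG = PowerDomination G k
    module PQ = PowerDomination G/X k
  open PG using (N[_]⊆_)

  S : Subset n
  S = T ∪ image r

  private
    P = Pow G k S
    Q = Pow G/X k (s ∷ T)

  settled-along : ∀ {a x} t → Reach (induced G X) a x → N[ a ]⊆ P t → ∃[ j ] N[ x ]⊆ P j
  settled-along t here           N[a]⊆P = t , N[a]⊆P
  settled-along t (step e walk) N[a]⊆P with E-induced⁻ G X e
  ... | e′ , w∈X = settled-along (suc t) walk (PG.N[]⊆-spread (P t) simple (deg≤ w∈X) N[a]⊆P e′)

  representative-settled : ∀ i → N[ r i ]⊆ P 0
  representative-settled i = PG.p⊆Nclosed S r∈S , PG.∈Nclosed⁺ S r∈S
    where
    r∈S = x∈p∪q⁺ (inj₂ (∈-image r i))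

  X-settled : ∃[ J ] ∀ {x} → x ∈ X → N[ x ]⊆ P J
  X-settled =
    map₂ (λ settled {x} → settled x) (∀-eventually (λ x j → x ∈ X → N[ x ]⊆ P j) mono eventually)
    where
    mono : ∀ x {i j} → i ≤ j → (x ∈ X → N[ x ]⊆ P i) → x ∈ X → N[ x ]⊆ P j
    mono x i≤j settled x∈X with settled x∈X
    ... | x∈P , N⊆P = PG.Pow-mono S i≤j x∈P , PG.Pow-mono S i≤j ∘ N⊆P
    eventually : ∀ x → ∃[ j ] (x ∈ X → N[ x ]⊆ P j)
    eventually x with x ∈? X
    ... | no  x∉X = 0 , λ x∈X → contradiction x∈X x∉X
    ... | yes x∈X with covers (x∈p∩q⁺ (x∈X , X⊆V x∈X))
    ...   | i , walk with settled-along 0 walk (representative-settled i)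
    ...     | j , settled = j , λ _ → settled

  module Simulation (J : ℕ) (settled : ∀ {x} → x ∈ X → N[ x ]⊆ P J) where

    late : ∀ i → P J ⊆ P (i + J)
    late i = PG.Pow-mono S (m≤n+m J i)

    X⊆P : ∀ i → X ⊆ P (i + J)
    X⊆P i = late i ∘ proj₁ ∘ settled

    N[X]⊆P : ∀ i → x ∈ X → E G x u ≡ true → u ∈ P (i + J)
    N[X]⊆P i x∈X e = late i (proj₂ (settled x∈X) e)

    simulate : ∀ i → suc u ∈ Q i → u ∈ P (i + J)
    simulate zero u∈ with PQ.∈Nclosed⁻ (s ∷ T) u∈
    ... | inj₁ u∈S′ = PG.Pow-mono S {j = J} z≤n (PG.p⊆Nclosed S (x∈p∪q⁺ (inj₁ (drop-there u∈S′))))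
    ... | inj₂ (zero , _ , e) with E-vX⁻ e
    ...   | x , x∈X , e′ = N[X]⊆P 0 x∈X e′
    simulate zero u∈ | inj₂ (suc v , v∈S′ , e) =
      PG.Pow-mono S {j = J} z≤n
        (PG.∈Nclosed⁺ S (x∈p∪q⁺ (inj₁ (drop-there v∈S′))) (proj₁ (E-contract⁻ e)))
    simulate (suc i) u∈ with PQ.∈stepP⁻ (Q i) u∈
    ... | inj₁ u∈Q = PG.p⊆stepP (P (i + J)) (simulate i u∈Q)
    ... | inj₂ (zero , _ , e) with E-vX⁻ e
    ...   | x , x∈X , e′ = N[X]⊆P (suc i) x∈X e′
    simulate (suc i) u∈ | inj₂ (suc v , f , e) with PQ.forces⁻ (Q i) (suc v) f | E-contract⁻ e
    ...   | v∈Q , few | e′ , v∉X , _ =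
      PG.stepP-closes (P (i + J)) (simulate i v∈Q)
        (≤-trans (∣N∩∁∣≤contract (P (i + J)) (Q i) v (X⊆P i) (simulate i) v∉X) few) e′

  IsKPDS-uncontract : (s ∷ T) ⊆ V G/X → (∃[ ℓ ] Q ℓ ≡ V G/X) → IsKPDS G k S
  IsKPDS-uncontract S′⊆V (ℓ , Qℓ≡V) with X-settled
  ... | J , settled = PG.IsKPDS-intro (ℓ + J) S⊆V V⊆P
    where
    open Simulation J settled
    S⊆V : S ⊆ V G
    S⊆V u∈ with x∈p∪q⁻ T (image r) u∈
    ... | inj₁ u∈T = proj₁ (∈V-contract⁻ (S′⊆V (there u∈T)))
    ... | inj₂ u∈R = proj₂ (x∈p∩q⁻ X (V G) (image⊆ r r∈ u∈R))
    V⊆P : V G ⊆ P (ℓ + J)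
    V⊆P {u} u∈V with u ∈? X
    ... | yes u∈X = X⊆P ℓ u∈X
    ... | no  u∉X = simulate ℓ (subst (suc u ∈_) (sym Qℓ≡V) (∈V-contract⁺ u∈V u∉X))

  ∣S∣≤ : ∣ S ∣ ≤ ∣ s ∷ T ∣ + c
  ∣S∣≤ = ≤-trans (∣p∪q∣≤∣p∣+∣q∣ T (image r)) (+-mono-≤ (∣p∣≤∣x∷p∣ s T) (∣image∣≤ r))

corollary4p6 : ∀ {n} (k : ℕ) (G : Graph n) (X : Subset n) →
    IsSimple G → Connected G → X ⊆ᵇ V G →
    (∀ x → in? X x ≡ true → deg G x ≤ suc k) →
    ∀ γG γGX c →
    IsPowDomNum G k γG → IsPowDomNum (contract G X) k γGX →
    NumComponents (induced G X) c →
    (γGX ∸ 1 ≤ γG) × (γG ≤ γGX + c)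
corollary4p6 k G X simple _ X⊆V deg≤ γG γGX c
  ((S , S-kpds , ∣S∣≡γG) , γG-min) ((s ∷ T , S′-kpds , ∣S′∣≡γGX) , γGX-min) (r , r∈ , _ , covers) =
  lower , upper
  where
  open ≤-Reasoning
  module L = LowerBound k G X S
  module U = UpperBound k G X simple (⊆ᵇ⇒⊆ X⊆V) (deg≤ _ ∘ ∈⇒in?)
                        r (in?⇒∈ ∘ r∈) (covers _ ∘ ∈⇒in?) s T

  lower : γGX ∸ 1 ≤ γG
  lower = ∸-monoˡ-≤ 1 $ begin
    γGX        ≤⟨ γGX-min L.S/X (L.IsKPDS-contract S-kpds) ⟩
    ∣ L.S/X ∣  ≤⟨ L.∣S/X∣≤ ⟩
    suc ∣ S ∣  ≡⟨ cong suc ∣S∣≡γG ⟩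
    suc γG     ∎

  upper : γG ≤ γGX + c
  upper = begin
    γG              ≤⟨ γG-min U.S (U.IsKPDS-uncontract (⊆ᵇ⇒⊆ (proj₁ S′-kpds)) (proj₂ S′-kpds)) ⟩
    ∣ U.S ∣         ≤⟨ U.∣S∣≤ ⟩
    ∣ s ∷ T ∣ + c   ≡⟨ cong (_+ c) ∣S′∣≡γGX ⟩
    γGX + c         ∎
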